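{- Let $a$ be an even integer and $b$ an odd integer such that $ak+b>0$ for every $k\in\mathbb{N}=\{1,2,3,\dots\}$, and let $O_{a,b}=\{ak+b : k\in\mathbb{N}\}$. Then the oriented odd-even graph $\overrightarrow{\mathcal{G}}_{\mathcal{E}}(O_{a,b})$ is unidirectional if and only if $4$ divides $a$.
   Context: $\mathcal{E}$ denotes the set of all non-negative even integers. For a set $A\subseteq\mathcal{E}$ and a set $O$ of positive odd integers, the oriented odd-even graph $\overrightarrow{\mathcal{G}}_A(O)$ has vertex set $A$ and an arc $a\to b$ iff $\frac{a+b}{2}\in O$ and $\frac{b-a}{2}\in O$ (so necessarily $b>a$). It is an oriented bipartite graph with partite sets $V_1=\{v\in A: v\equiv 0 \pmod 4\}$ and $V_2=\{v\in A: v\equiv 2\pmod 4\}$. An oriented bipartite graph with partite sets $V_1,V_2$ is unidirectional if either every arc goes from $V_1$ to $V_2$ or every arc goes from $V_2$ to $V_1$. -}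

module Defs where

open import Data.Nat using (ℕ) renaming (_≤_ to _≤ℕ_)
open import Data.Integer using (ℤ; +_; _+_; _-_; _*_; _<_; _≤_)
open import Data.Integer.Divisibility using (_∣_)
open import Data.Product using (Σ; ∃; ∃-syntax; _×_)
open import Data.Sum using (_⊎_)
open import Relation.Binary.PropositionalEquality using (_≡_)

OddZ : ℤ → Set
OddZ z = ∃[ q ] z ≡ + 2 * q + + 1

ℰ : ℤ → Set
ℰ x = (+ 0 ≤ x) × (+ 2 ∣ x)

O[_,_] : ℤ → ℤ → ℤ → Set
O[ a , b ] z = ∃[ k ] (1 ≤ℕ k) × (z ≡ a * + k + b)

-- Arc a → b of the oriented odd-even graph G_A(O):
-- (a+b)/2 ∈ O and (b-a)/2 ∈ O (halves written as h with 2h = ...).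
OddEvenArc : (ℤ → Set) → ℤ → ℤ → Set
OddEvenArc O x y =
  (∃[ h ] (x + y ≡ + 2 * h) × O h) × (∃[ h ] (y - x ≡ + 2 * h) × O h)

V₁ : (ℤ → Set) → ℤ → Set
V₁ A v = A v × (+ 4 ∣ v)

V₂ : (ℤ → Set) → ℤ → Set
V₂ A v = A v × (∃[ q ] v ≡ + 4 * q + + 2)

Unidirectional : (A : ℤ → Set) (P₁ P₂ : ℤ → Set) (Arc : ℤ → ℤ → Set) → Set
Unidirectional A P₁ P₂ Arc =
  (∀ x y → A x → A y → Arc x y → P₁ x × P₂ y)
  ⊎ (∀ x y → A x → A y → Arc x y → P₂ x × P₁ y)

OddEvenUnidirectional : (ℤ → Set) → (ℤ → Set) → Set
OddEvenUnidirectional A O = Unidirectional A (V₁ A) (V₂ A) (OddEvenArc O)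

-- An arc x → y of G_ℰ(O) is exactly a pair of halves h₁ h₂ ∈ O with x = h₁ − h₂ and
-- y = h₁ + h₂. For O = O_{a,b} this gives x = a(k₁ − k₂) and y = a(k₁ + k₂) + 2b, so
-- when 4 ∣ a every tail is 0 and every head is 2 modulo 4. Conversely, the halves
-- h₁ = h₂ = a + b give an arc out of 0 ∈ V₁, which forces the orientation V₁ → V₂,
-- and the halves a + b and 2a + b give an arc whose tail is ±a, so 4 ∣ a.
module Submission where

open import Defs
open import Data.Nat using (ℕ; _≤_; s≤s; z≤n)
open import Data.Integer using (ℤ; +_; _+_; _*_; _<_; -_; _-_) renaming (_≤_ to _≤ℤ_)
open import Data.Integer.Divisibility using (_∣_)
open import Function.Bundles using (_⇔_; mk⇔)
open import Function.Base using (_∘_)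

import Data.Nat.Divisibility as ℕ
open import Data.Integer.Properties
  using (*-cancelˡ-≡; +-mono-≤; +-inverseʳ; ≤-refl; ≤-trans; ≤-total; <⇒≤; i≤j⇒0≤j-i; ∣-i∣≡∣i∣)
import Data.Integer.Divisibility.Signed as Signed
open import Data.Integer.Tactic.RingSolver using (solve-∀)
open import Data.Product using (_,_; _×_; ∃-syntax; proj₁; proj₂)
open import Data.Sum using (inj₁; inj₂; [_,_]′)
open import Data.Empty using (⊥-elim)
open import Relation.Nullary using (¬_)
open import Relation.Binary.PropositionalEquality using (_≡_; refl; sym; trans; cong₂; subst)

ℰ-intro : ∀ {x} → + 0 ≤ℤ x → + 2 Signed.∣ x → ℰ x
ℰ-intro 0≤x 2∣x = 0≤x , Signed.∣⇒∣ᵤ 2∣x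

4∤4q+2 : ∀ q → ¬ + 4 Signed.∣ + 4 * q + + 2
4∤4q+2 q 4∣4q+2 = 4∤2 (Signed.∣m+n∣m⇒∣n 4∣4q+2 (Signed.∣m⇒∣m*n q Signed.∣-refl))
  where
  4∤2 : ¬ + 4 Signed.∣ + 2
  4∤2 4∣2 with ℕ.∣⇒≤ (Signed.∣⇒∣ᵤ 4∣2)
  ... | s≤s (s≤s ())

arc⇒halves : ∀ {O x y} → OddEvenArc O x y →
             ∃[ h₁ ] ∃[ h₂ ] O h₁ × O h₂ × x ≡ h₁ - h₂ × y ≡ h₁ + h₂
arc⇒halves {x = x} {y} ((h₁ , x+y≡2h₁ , h₁∈O) , (h₂ , y-x≡2h₂ , h₂∈O)) =
  h₁ , h₂ , h₁∈O , h₂∈O ,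
  *-cancelˡ-≡ (+ 2) x (h₁ - h₂)
    (trans (twice-tail x y) (trans (cong₂ _-_ x+y≡2h₁ y-x≡2h₂) (*-distrib-minus h₁ h₂))) ,
  *-cancelˡ-≡ (+ 2) y (h₁ + h₂)
    (trans (twice-head x y) (trans (cong₂ _+_ x+y≡2h₁ y-x≡2h₂) (*-distrib-plus h₁ h₂)))
  where
  twice-tail : ∀ x y → + 2 * x ≡ (x + y) - (y - x)
  twice-tail = solve-∀
  twice-head : ∀ x y → + 2 * y ≡ (x + y) + (y - x)
  twice-head = solve-∀
  *-distrib-minus : ∀ u v → + 2 * u - + 2 * v ≡ + 2 * (u - v)
  *-distrib-minus = solve-∀
  *-distrib-plus : ∀ u v → + 2 * u + + 2 * v ≡ + 2 * (u + v)
  *-distrib-plus = solve-∀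

halves⇒arc : ∀ {O h₁ h₂} → O h₁ → O h₂ → OddEvenArc O (h₁ - h₂) (h₁ + h₂)
halves⇒arc {h₁ = h₁} {h₂} h₁∈O h₂∈O =
  (h₁ , tail+head h₁ h₂ , h₁∈O) , (h₂ , head-tail h₁ h₂ , h₂∈O)
  where
  tail+head : ∀ u v → (u - v) + (u + v) ≡ + 2 * u
  tail+head = solve-∀
  head-tail : ∀ u v → (u + v) - (u - v) ≡ + 2 * v
  head-tail = solve-∀

ArcsGo : (ℤ → Set) → (ℤ → Set) → (ℤ → Set) → Set
ArcsGo O P Q = ∀ x y → ℰ x → ℰ y → OddEvenArc O x y → P x × Q y

halves-arc-goes : ∀ {O P Q h₁ h₂} → ArcsGo O P Q → O h₁ → O h₂ →
                  + 0 ≤ℤ h₂ → h₂ ≤ℤ h₁ → + 2 Signed.∣ h₁ - h₂ → P (h₁ - h₂) × Q (h₁ + h₂)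
halves-arc-goes {h₁ = h₁} {h₂} arcs h₁∈O h₂∈O 0≤h₂ h₂≤h₁ 2∣h₁-h₂ =
  arcs (h₁ - h₂) (h₁ + h₂) (ℰ-intro (i≤j⇒0≤j-i h₂≤h₁) 2∣h₁-h₂) (ℰ-intro 0≤h₁+h₂ 2∣h₁+h₂)
       (halves⇒arc h₁∈O h₂∈O)
  where
  0≤h₁+h₂ : + 0 ≤ℤ h₁ + h₂
  0≤h₁+h₂ = +-mono-≤ (≤-trans 0≤h₂ h₂≤h₁) 0≤h₂
  head≡tail+2h₂ : ∀ u v → u + v ≡ (u - v) + v * + 2
  head≡tail+2h₂ = solve-∀
  2∣h₁+h₂ : + 2 Signed.∣ h₁ + h₂
  2∣h₁+h₂ = subst (+ 2 Signed.∣_) (sym (head≡tail+2h₂ h₁ h₂))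
              (Signed.∣m∣n⇒∣m+n 2∣h₁-h₂ (Signed.∣n⇒∣m*n h₂ Signed.∣-refl))

∣h-h : ∀ {d} h → d Signed.∣ h - h
∣h-h h = Signed.divides (+ 0) (+-inverseʳ h)

unidirectional⇒V₁→V₂ : ∀ {O h} → O h → + 0 ≤ℤ h →
                        OddEvenUnidirectional ℰ O → ArcsGo O (V₁ ℰ) (V₂ ℰ)
unidirectional⇒V₁→V₂ h∈O 0≤h (inj₁ V₁→V₂) = V₁→V₂
unidirectional⇒V₁→V₂ {h = h} h∈O 0≤h (inj₂ V₂→V₁)
  with halves-arc-goes V₂→V₁ h∈O h∈O 0≤h ≤-refl (∣h-h h)
... | (_ , q , h-h≡4q+2) , _ = ⊥-elim (4∤4q+2 q (subst (+ 4 Signed.∣_) h-h≡4q+2 (∣h-h h)))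

4∣a⇒V₁→V₂ : ∀ {a b} → + 4 Signed.∣ a → OddZ b → ArcsGo O[ a , b ] (V₁ ℰ) (V₂ ℰ)
4∣a⇒V₁→V₂ (Signed.divides c refl) (q , refl) x y x∈ℰ y∈ℰ arc
  with arc⇒halves {x = x} {y} arc
... | _ , _ , (k₁ , _ , refl) , (k₂ , _ , refl) , refl , refl =
  (x∈ℰ , Signed.∣⇒∣ᵤ (Signed.divides (c * + k₁ - c * + k₂)
                                       (tail c (+ k₁) (+ k₂) (+ 2 * q + + 1)))) ,
  (y∈ℰ , c * + k₁ + c * + k₂ + q , head c (+ k₁) (+ k₂) q)
  where
  tail : ∀ c k₁ k₂ b → (c * + 4 * k₁ + b) - (c * + 4 * k₂ + b) ≡ (c * k₁ - c * k₂) * + 4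
  tail = solve-∀
  head : ∀ c k₁ k₂ q → (c * + 4 * k₁ + (+ 2 * q + + 1)) + (c * + 4 * k₂ + (+ 2 * q + + 1))
                       ≡ + 4 * (c * k₁ + c * k₂ + q) + + 2
  head = solve-∀

V₁→V₂⇒4∣a : ∀ {a b} → + 2 Signed.∣ a → ((k : ℕ) → 1 ≤ k → + 0 < a * + k + b) →
            ArcsGo O[ a , b ] (V₁ ℰ) (V₂ ℰ) → + 4 ∣ a
V₁→V₂⇒4∣a {a} {b} 2∣a positive V₁→V₂ = [ from-h₁≤h₂ , from-h₂≤h₁ ]′ (≤-total h₁ h₂)
  where
  h₁ h₂ : ℤ
  h₁ = a * + 1 + b
  h₂ = a * + 2 + b
  h₁∈O : O[ a , b ] h₁
  h₁∈O = 1 , s≤s z≤n , refl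
  h₂∈O : O[ a , b ] h₂
  h₂∈O = 2 , s≤s z≤n , refl
  h₂-h₁≡a : h₂ - h₁ ≡ a
  h₂-h₁≡a = identity a b
    where
    identity : ∀ a b → (a * + 2 + b) - (a * + 1 + b) ≡ a
    identity = solve-∀
  h₁-h₂≡-a : h₁ - h₂ ≡ - a
  h₁-h₂≡-a = identity a b
    where
    identity : ∀ a b → (a * + 1 + b) - (a * + 2 + b) ≡ - a
    identity = solve-∀
  tail-in-V₁ : ∀ {h h′} → O[ a , b ] h → O[ a , b ] h′ → h′ ≤ℤ h → + 2 Signed.∣ h - h′ →
               + 4 ∣ h - h′
  tail-in-V₁ h∈O h′∈O@(k , 1≤k , refl) h′≤h 2∣h-h′ =
    proj₂ (proj₁ (halves-arc-goes V₁→V₂ h∈O h′∈O (<⇒≤ (positive k 1≤k)) h′≤h 2∣h-h′))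
  from-h₁≤h₂ : h₁ ≤ℤ h₂ → + 4 ∣ a
  from-h₁≤h₂ h₁≤h₂ =
    subst (+ 4 ∣_) h₂-h₁≡a (tail-in-V₁ h₂∈O h₁∈O h₁≤h₂ (subst (+ 2 Signed.∣_) (sym h₂-h₁≡a) 2∣a))
  from-h₂≤h₁ : h₂ ≤ℤ h₁ → + 4 ∣ a
  from-h₂≤h₁ h₂≤h₁ =
    subst (4 ℕ.∣_) (∣-i∣≡∣i∣ a)
      (subst (+ 4 ∣_) h₁-h₂≡-a
        (tail-in-V₁ h₁∈O h₂∈O h₂≤h₁ (subst (+ 2 Signed.∣_) (sym h₁-h₂≡-a) (Signed.∣m⇒∣-m 2∣a))))

mainTheorem4 : (a b : ℤ) → + 2 ∣ a → OddZ b →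
               ((k : ℕ) → 1 ≤ k → + 0 < a * + k + b) →
               OddEvenUnidirectional ℰ O[ a , b ] ⇔ (+ 4 ∣ a)
mainTheorem4 a b 2∣a b-odd positive = mk⇔ unidirectional⇒4∣a 4∣a⇒unidirectional
  where
  unidirectional⇒4∣a : OddEvenUnidirectional ℰ O[ a , b ] → + 4 ∣ a
  unidirectional⇒4∣a =
    V₁→V₂⇒4∣a {a} {b} (Signed.∣ᵤ⇒∣ 2∣a) positive
    ∘ unidirectional⇒V₁→V₂ (1 , s≤s z≤n , refl) (<⇒≤ (positive 1 (s≤s z≤n)))
  4∣a⇒unidirectional : + 4 ∣ a → OddEvenUnidirectional ℰ O[ a , b ]
  4∣a⇒unidirectional 4∣a = inj₁ (4∣a⇒V₁→V₂ {a} {b} (Signed.∣ᵤ⇒∣ 4∣a) b-odd)
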